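{- Let $G=(V,E)$ be a finite simple graph and let $C=(S,T)$ be a maximum cut of $G$ (i.e., $V=S\cup T$ is a partition maximizing the number of edges with one endpoint in $S$ and one in $T$). Let $F\subseteq E(S) \cup E(T)$ and let $\sigma$ be an orientation of the edge set $F$ (i.e., each edge $\{u,v\}\in F$ is assigned exactly one of the ordered pairs $(u,v)$ or $(v,u)$). Let $G_{C,F,\sigma}$ be the directed multigraph network constructed as follows: (i) its vertex set is $V$ together with a new source node $s$ and a new sink node $t$; (ii) for each edge $\{u,v\} \in E(S,T)$, insert the two arcs $(u,v)$ and $(v,u)$, each with capacity $1$; (iii) for each edge $\{u,v\} \in F$ with orientation $(u,v) \in \sigma$, insert the arcs $(s,u)$ and $(v,t)$, each with capacity $1$ (possibly creating parallel arcs); the arc $(u,v)$ itself is not inserted. Then in the network $G_{C,F,\sigma}$ there exists an $s$-$t$-flow of value $|F|$.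
   Context: For $X\subseteq V$, $E(X)$ denotes the edge set of the induced subgraph $G[X]$; for disjoint $X,Y\subseteq V$, $E(X,Y)$ denotes the set of edges with one endpoint in $X$ and one in $Y$. -}

module Defs where

open import Data.Bool using (Bool; true; false; _∧_; _xor_; if_then_else_)
open import Data.Nat using (ℕ; _<ᵇ_)
open import Data.Fin using (Fin; toℕ)
open import Data.Fin.Properties using () renaming (_≟_ to _≟F_)
open import Data.List using (List; []; _∷_; _++_; map; concatMap; filterᵇ; length; lookup; allFin)
open import Data.List.Relation.Unary.All using (All)
open import Data.List.Relation.Unary.AllPairs using (AllPairs)
open import Data.Product using (_×_; _,_; ∃)
open import Data.Sum using (_⊎_)
open import Data.Integer using (+_)
open import Data.Rational using (ℚ; 0ℚ; 1ℚ; _+_; _-_; _≤_; _/_)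
open import Relation.Binary.PropositionalEquality using (_≡_)
open import Relation.Nullary using (¬_; does)

record SimpleGraph (n : ℕ) : Set where
  field
    adj    : Fin n → Fin n → Bool
    sym    : ∀ u v → adj u v ≡ adj v u
    irrefl : ∀ u → adj u u ≡ false
open SimpleGraph public

-- A cut (S,T) is given by its side indicator: S u ≡ true means u ∈ S, else u ∈ T.
Cut : ℕ → Set
Cut n = Fin n → Bool

allPairs : (n : ℕ) → List (Fin n × Fin n)
allPairs n = concatMap (λ i → map (λ j → (i , j)) (allFin n)) (allFin n)

cutEdges : ∀ {n} → SimpleGraph n → Cut n → List (Fin n × Fin n)
cutEdges {n} G S =
  filterᵇ (λ { (u , v) → (toℕ u <ᵇ toℕ v) ∧ (adj G u v ∧ (S u xor S v)) }) (allPairs n)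

cutSize : ∀ {n} → SimpleGraph n → Cut n → ℕ
cutSize G S = length (cutEdges G S)

IsMaxCut : ∀ {n} → SimpleGraph n → Cut n → Set
IsMaxCut {n} G S = ∀ (S′ : Cut n) → cutSize G S′ Data.Nat.≤ cutSize G S

SameEdge : ∀ {n} → Fin n × Fin n → Fin n × Fin n → Set
SameEdge (u , v) (u′ , v′) = (u ≡ u′ × v ≡ v′) ⊎ (u ≡ v′ × v ≡ u′)

-- An oriented edge set (F,σ) with F ⊆ E(S) ∪ E(T): a list of arcs (u,v), one per edge
-- of F, oriented according to σ; each is an edge of G with both ends on the same side,
-- and no undirected edge occurs twice. |F| is the length of the list.
IsOrientedInternalEdgeSet : ∀ {n} → SimpleGraph n → Cut n → List (Fin n × Fin n) → Set
IsOrientedInternalEdgeSet G S Fσ =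
  All (λ { (u , v) → adj G u v ≡ true × S u ≡ S v }) Fσ
  × AllPairs (λ e e′ → ¬ SameEdge e e′) Fσ

data Node (n : ℕ) : Set where
  inner : Fin n → Node n
  src   : Node n
  snk   : Node n

eqNode : ∀ {n} → Node n → Node n → Bool
eqNode (inner u) (inner v) = does (u ≟F v)
eqNode src src = true
eqNode snk snk = true
eqNode _ _ = false

-- arcs of G_{C,F,σ} (a multiset, as a list); every arc has capacity 1
networkArcs : ∀ {n} → SimpleGraph n → Cut n → List (Fin n × Fin n) → List (Node n × Node n)
networkArcs {n} G S Fσ =
  map (λ { (u , v) → (inner u , inner v) })
      (filterᵇ (λ { (u , v) → adj G u v ∧ (S u xor S v) }) (allPairs n))
  ++ concatMap (λ { (u , v) → (src , inner u) ∷ (inner v , snk) ∷ [] }) Fσ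

Σ : ∀ {m} → (Fin m → ℚ) → ℚ
Σ {ℕ.zero} f = 0ℚ
Σ {ℕ.suc m} f = f Fin.zero + Σ (λ i → f (Fin.suc i))

module _ {n : ℕ} (arcs : List (Node n × Node n)) (f : Fin (length arcs) → ℚ) where
  private
    tl hd : Fin (length arcs) → Node n
    tl a with lookup arcs a
    ... | (x , _) = x
    hd a with lookup arcs a
    ... | (_ , y) = y

  inflow outflow : Node n → ℚ
  inflow x  = Σ (λ a → if eqNode (hd a) x then f a else 0ℚ)
  outflow x = Σ (λ a → if eqNode (tl a) x then f a else 0ℚ)

  IsFlow : Set
  IsFlow = (∀ a → (0ℚ ≤ f a) × (f a ≤ 1ℚ)) × (∀ v → inflow (inner v) ≡ outflow (inner v))

  flowValue : ℚ
  flowValue = outflow src - inflow src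

HasFlowOfValue : ∀ {n} → List (Node n × Node n) → ℕ → Set
HasFlowOfValue arcs k =
  ∃ λ (f : Fin (length arcs) → ℚ) → IsFlow arcs f × flowValue arcs f ≡ (+ k) / 1

-- A unit-capacity network has an s-t flow of value L as soon as every s-t cut {s} ∪ R has at least L
-- leaving arcs: augmenting along residual paths raises an integral flow one unit at a time, and when no
-- augmenting path exists the vertices reachable from s form a saturated cut whose capacity equals the
-- current flow value.
--
-- In G_{C,F,σ} a cut {s} ∪ R is crossed by (s,u) or (v,t) for every (u,v) ∈ σ except those with u ∈ R,
-- v ∉ R; these are edges of E(S) ∪ E(T) from R to V ∖ R. Moving R to the other side of C swaps the
-- edges between R and V ∖ R in and out of the cut, so maximality of C bounds their number by the number
-- of cut edges between R and V ∖ R, each of which gives an arc of the network leaving {s} ∪ R.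

module Submission where

open import Defs hiding (sym)
open import Data.Bool using (Bool; true; false; _∧_; _∨_; not; _xor_; if_then_else_)
import Data.Bool.Properties as 𝔹
open import Data.Nat using (ℕ; zero; suc; z≤n; s≤s; _<ᵇ_) renaming (_+_ to _+ℕ_; _≤_ to _≤ℕ_; _<_ to _<ℕ_)
import Data.Nat.Properties as ℕ
import Data.Nat.Coprimality as Coprime
open import Data.Fin using (Fin; toℕ) renaming (zero to fzero; suc to fsuc)
open import Data.Fin.Properties using (_≟_; any?; toℕ-injective)
open import Data.List using (List; []; _∷_; _++_; map; concatMap; filterᵇ; length; lookup; allFin; tabulate)
open import Data.List.Relation.Unary.All as All using (All; []; _∷_)
open import Data.List.Relation.Unary.AllPairs as AllPairs using (AllPairs; []; _∷_)
open import Data.Product using (_×_; _,_; ∃; proj₁; proj₂)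
open import Function using (_∘_; Equivalence)
import Algebra.Bundles
open import Data.Sum using (_⊎_; inj₁; inj₂)
open import Data.Empty using (⊥-elim)
import Data.Integer as ℤ
import Data.Integer.Properties as ℤ
open import Data.Rational using (ℚ; 0ℚ; 1ℚ; _+_; _-_; -_; _≤_; _/_; ↥_; mkℚ; *≤*)
import Data.Rational.Properties as ℚ
open import Data.Rational.Solver using (module +-*-Solver)
open import Relation.Binary using (tri<; tri≈; tri>)
open import Relation.Binary.PropositionalEquality
open import Relation.Nullary using (¬_; does; yes; no; Dec)
open import Relation.Nullary.Decidable using (_×-dec_; _⊎-dec_)

open +-*-Solver using (solve; _:=_; _:+_; _:-_; :-_)

Σ-cong : ∀ {m} {f g : Fin m → ℚ} → (∀ a → f a ≡ g a) → Σ f ≡ Σ g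
Σ-cong {zero}  eq = refl
Σ-cong {suc m} eq = cong₂ _+_ (eq fzero) (Σ-cong (λ a → eq (fsuc a)))

Σ-zero : ∀ m → Σ {m} (λ _ → 0ℚ) ≡ 0ℚ
Σ-zero zero    = refl
Σ-zero (suc m) = cong (0ℚ +_) (Σ-zero m)

Σ-distrib-+ : ∀ {m} (f g : Fin m → ℚ) → Σ (λ a → f a + g a) ≡ Σ f + Σ g
Σ-distrib-+ {zero}  f g = refl
Σ-distrib-+ {suc m} f g =
  trans (cong (f fzero + g fzero +_) (Σ-distrib-+ (λ a → f (fsuc a)) (λ a → g (fsuc a))))
        (solve 4 (λ a b c d → (a :+ b) :+ (c :+ d) := (a :+ c) :+ (b :+ d)) refl
               (f fzero) (g fzero) (Σ (λ a → f (fsuc a))) (Σ (λ a → g (fsuc a))))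

Σ-distrib-neg : ∀ {m} (f : Fin m → ℚ) → Σ (λ a → - f a) ≡ - Σ f
Σ-distrib-neg {zero}  f = refl
Σ-distrib-neg {suc m} f =
  trans (cong (- f fzero +_) (Σ-distrib-neg (λ a → f (fsuc a))))
        (sym (ℚ.neg-distrib-+ (f fzero) _))

Σ-distrib-- : ∀ {m} (f g : Fin m → ℚ) → Σ (λ a → f a - g a) ≡ Σ f - Σ g
Σ-distrib-- f g = trans (Σ-distrib-+ f (λ a → - g a)) (cong (Σ f +_) (Σ-distrib-neg g))

Σ-indicator : ∀ {m} (a : Fin m) (g : Fin m → ℚ) → Σ (λ b → if does (a ≟ b) then g b else 0ℚ) ≡ g a
Σ-indicator {suc m} fzero    g = trans (cong (g fzero +_) (Σ-zero m)) (ℚ.+-identityʳ (g fzero))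
Σ-indicator {suc m} (fsuc a) g =
  trans (cong (0ℚ +_) (Σ-indicator a (λ b → g (fsuc b)))) (ℚ.+-identityˡ _)

Σ-comm : ∀ {k m} (F : Fin k → Fin m → ℚ) → Σ (λ i → Σ (F i)) ≡ Σ (λ a → Σ (λ i → F i a))
Σ-comm {zero}  {m} F = sym (Σ-zero m)
Σ-comm {suc k} {m} F =
  trans (cong (Σ (F fzero) +_) (Σ-comm (λ i → F (fsuc i))))
        (sym (Σ-distrib-+ (F fzero) (λ a → Σ (λ i → F (fsuc i) a))))

if-same : ∀ {A : Set} (b : Bool) (x : A) → (if b then x else x) ≡ x
if-same true  x = refl
if-same false x = refl

Σℕ : ∀ {m} → (Fin m → ℕ) → ℕ
Σℕ {zero}  f = 0
Σℕ {suc m} f = f fzero +ℕ Σℕ (λ i → f (fsuc i))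

Σℕ-cong : ∀ {m} {f g : Fin m → ℕ} → (∀ a → f a ≡ g a) → Σℕ f ≡ Σℕ g
Σℕ-cong {zero}  eq = refl
Σℕ-cong {suc m} eq = cong₂ _+ℕ_ (eq fzero) (Σℕ-cong (λ a → eq (fsuc a)))

Σℕ-zero : ∀ m → Σℕ {m} (λ _ → 0) ≡ 0
Σℕ-zero zero    = refl
Σℕ-zero (suc m) = Σℕ-zero m

Σℕ-one : ∀ m → Σℕ {m} (λ _ → 1) ≡ m
Σℕ-one zero    = refl
Σℕ-one (suc m) = cong suc (Σℕ-one m)

Σℕ-distrib-+ : ∀ {m} (f g : Fin m → ℕ) → Σℕ (λ a → f a +ℕ g a) ≡ Σℕ f +ℕ Σℕ g
Σℕ-distrib-+ {zero}  f g = refl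
Σℕ-distrib-+ {suc m} f g =
  trans (cong (f fzero +ℕ g fzero +ℕ_) (Σℕ-distrib-+ (λ a → f (fsuc a)) (λ a → g (fsuc a))))
        (ℕ-interchange (f fzero) (g fzero) _ _)
  where open import Algebra.Properties.CommutativeSemigroup ℕ.+-commutativeSemigroup
          using () renaming (interchange to ℕ-interchange)

Σℕ-indicator : ∀ {m} (a : Fin m) (g : Fin m → ℕ) → Σℕ (λ b → if does (a ≟ b) then g b else 0) ≡ g a
Σℕ-indicator {suc m} fzero    g = trans (cong (g fzero +ℕ_) (Σℕ-zero m)) (ℕ.+-identityʳ (g fzero))
Σℕ-indicator {suc m} (fsuc a) g = Σℕ-indicator a (λ b → g (fsuc b))

Σℕ-comm : ∀ {k m} (F : Fin k → Fin m → ℕ) → Σℕ (λ i → Σℕ (F i)) ≡ Σℕ (λ a → Σℕ (λ i → F i a))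
Σℕ-comm {zero}  {m} F = sym (Σℕ-zero m)
Σℕ-comm {suc k} {m} F =
  trans (cong (Σℕ (F fzero) +ℕ_) (Σℕ-comm (λ i → F (fsuc i))))
        (sym (Σℕ-distrib-+ (F fzero) (λ a → Σℕ (λ i → F (fsuc i) a))))

Σℕ-split : ∀ {m} (j : Fin m) (g : Fin m → ℕ) → Σℕ g ≡ Σℕ (λ i → if does (j ≟ i) then 0 else g i) +ℕ g j
Σℕ-split j g = begin
  Σℕ g                                     ≡⟨ Σℕ-cong split ⟩
  Σℕ (λ i → away i +ℕ at i)                ≡⟨ Σℕ-distrib-+ away at ⟩
  Σℕ away +ℕ Σℕ at                         ≡⟨ cong (Σℕ away +ℕ_) (Σℕ-indicator j g) ⟩
  Σℕ away +ℕ g j                           ∎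
  where
  open ≡-Reasoning
  away at : _ → ℕ
  away i = if does (j ≟ i) then 0 else g i
  at   i = if does (j ≟ i) then g i else 0
  split : ∀ i → g i ≡ away i +ℕ at i
  split i with does (j ≟ i)
  ... | true  = refl
  ... | false = sym (ℕ.+-identityʳ _)

bit : Bool → ℕ
bit true  = 1
bit false = 0

bitℚ : Bool → ℚ
bitℚ b = if b then 1ℚ else 0ℚ

fromℕ : ℕ → ℚ
fromℕ k = ℤ.+ k / 1

fromℕ-normal : ∀ k → fromℕ k ≡ mkℚ (ℤ.+ k) 0 (Coprime.sym (Coprime.1-coprimeTo k))
fromℕ-normal k = ℚ.normalize-coprime _

fromℕ-suc : ∀ k → fromℕ (suc k) ≡ 1ℚ + fromℕ k
fromℕ-suc k rewrite fromℕ-normal k =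
  ℚ./-cong {p₁ = ℤ.+ suc k} {q₁ = 1} (sym (cong (ℤ._+_ (ℤ.+ 1)) (ℤ.*-identityʳ (ℤ.+ k)))) refl

fromℕ-injective : ∀ {a b} → fromℕ a ≡ fromℕ b → a ≡ b
fromℕ-injective {a} {b} eq =
  ℤ.+-injective (cong ↥_ (trans (sym (fromℕ-normal a)) (trans eq (fromℕ-normal b))))

ZeroOne : ∀ {m} → (Fin m → ℚ) → Set
ZeroOne h = ∀ a → h a ≡ 0ℚ ⊎ h a ≡ 1ℚ

bump : ∀ {m} → (Fin m → ℚ) → Fin m → ℚ → Fin m → ℚ
bump h a c b = h b + (if does (a ≟ b) then c else 0ℚ)

bump-zeroOne : ∀ {m} {h : Fin m → ℚ} {a} c → ZeroOne h →
               (h a + c ≡ 0ℚ ⊎ h a + c ≡ 1ℚ) → ZeroOne (bump h a c)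
bump-zeroOne {h = h} {a} c h01 ha+c b with a ≟ b
... | yes refl = ha+c
... | no  _    rewrite ℚ.+-identityʳ (h b) = h01 b

Σ-bump : ∀ {m} (P : Fin m → Bool) (h : Fin m → ℚ) (a : Fin m) (c : ℚ) →
         Σ (λ b → if P b then bump h a c b else 0ℚ)
           ≡ Σ (λ b → if P b then h b else 0ℚ) + (if P a then c else 0ℚ)
Σ-bump P h a c = begin
  Σ (λ b → if P b then bump h a c b else 0ℚ)   ≡⟨ Σ-cong split ⟩
  Σ (λ b → old b + new b)                       ≡⟨ Σ-distrib-+ old new ⟩
  Σ old + Σ new                                 ≡⟨ cong (Σ old +_) (Σ-indicator a (λ b → if P b then c else 0ℚ)) ⟩
  Σ old + (if P a then c else 0ℚ)               ∎
  where
  open ≡-Reasoning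
  old new : _ → ℚ
  old b = if P b then h b else 0ℚ
  new b = if does (a ≟ b) then (if P b then c else 0ℚ) else 0ℚ
  split : ∀ b → (if P b then bump h a c b else 0ℚ) ≡ old b + new b
  split b with P b | does (a ≟ b)
  ... | true  | _     = refl
  ... | false | true  = sym (ℚ.+-identityʳ 0ℚ)
  ... | false | false = sym (ℚ.+-identityʳ 0ℚ)

NodeSet : ℕ → Set
NodeSet n = Node n → Bool

withSource : ∀ {n} → (Fin n → Bool) → NodeSet n
withSource R src       = true
withSource R snk       = false
withSource R (inner i) = R i

module Network {n : ℕ} (arcs : List (Node n × Node n)) where

  Arc : Set
  Arc = Fin (length arcs)

  tail head : Arc → Node n
  tail a = proj₁ (lookup arcs a)
  head a = proj₂ (lookup arcs a)

  excess : (Arc → ℚ) → Node n → ℚ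
  excess f z = inflow arcs f z - outflow arcs f z

  excess-bump : ∀ (h : Arc → ℚ) a c z →
    excess (bump h a c) z ≡ excess h z + ((if eqNode (head a) z then c else 0ℚ) - (if eqNode (tail a) z then c else 0ℚ))
  excess-bump h a c z =
    trans (cong₂ _-_ (Σ-bump (λ b → eqNode (head b) z) h a c) (Σ-bump (λ b → eqNode (tail b) z) h a c))
          (solve 4 (λ I p O q → (I :+ p) :- (O :+ q) := (I :- O) :+ (p :- q)) refl
                 (inflow arcs h z) _ (outflow arcs h z) _)

  ΣNode : (Node n → ℚ) → ℚ
  ΣNode g = g src + (g snk + Σ (λ i → g (inner i)))

  ΣNode-cong : ∀ {g g′ : Node n → ℚ} → (∀ z → g z ≡ g′ z) → ΣNode g ≡ ΣNode g′
  ΣNode-cong eq = cong₂ _+_ (eq src) (cong₂ _+_ (eq snk) (Σ-cong (λ i → eq (inner i))))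

  ΣNode-Σ-comm : ∀ (F : Node n → Arc → ℚ) → ΣNode (λ z → Σ (F z)) ≡ Σ (λ a → ΣNode (λ z → F z a))
  ΣNode-Σ-comm F =
    trans (cong (λ w → Σ (F src) + (Σ (F snk) + w)) (Σ-comm (λ i → F (inner i))))
    (trans (cong (Σ (F src) +_) (sym (Σ-distrib-+ (F snk) (λ a → Σ (λ i → F (inner i) a)))))
           (sym (Σ-distrib-+ (F src) (λ a → F snk a + Σ (λ i → F (inner i) a)))))

  ΣNode-distrib-- : ∀ (f g : Node n → ℚ) → ΣNode (λ z → f z - g z) ≡ ΣNode f - ΣNode g
  ΣNode-distrib-- f g =
    trans (cong (λ w → (f src - g src) + ((f snk - g snk) + w)) (Σ-distrib-- (λ i → f (inner i)) (λ i → g (inner i))))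
          (solve 6 (λ a b c d e h → (a :- b) :+ ((c :- d) :+ (e :- h)) := (a :+ (c :+ e)) :- (b :+ (d :+ h))) refl
                 (f src) (g src) (f snk) (g snk) _ _)

  ΣNode-indicator : ∀ (X : NodeSet n) (w : Node n) (c : ℚ) →
    ΣNode (λ z → if X z then (if eqNode w z then c else 0ℚ) else 0ℚ) ≡ (if X w then c else 0ℚ)
  ΣNode-indicator X w c = trans (ΣNode-cong swap) (at w)
    where
    swap : ∀ z → (if X z then (if eqNode w z then c else 0ℚ) else 0ℚ)
               ≡ (if eqNode w z then (if X z then c else 0ℚ) else 0ℚ)
    swap z with X z | eqNode w z
    ... | true  | _     = refl
    ... | false | true  = refl
    ... | false | false = refl
    rest-zero : ∀ {m} (g : Fin m → Bool) → Σ (λ i → if g i then 0ℚ else 0ℚ) ≡ 0ℚ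
    rest-zero {m} g = trans (Σ-cong (λ i → if-same (g i) 0ℚ)) (Σ-zero m)
    at : ∀ w → ΣNode (λ z → if eqNode w z then (if X z then c else 0ℚ) else 0ℚ) ≡ (if X w then c else 0ℚ)
    at src = trans (cong (λ s → (if X src then c else 0ℚ) + (0ℚ + s)) (rest-zero {n} (λ _ → false)))
                   (ℚ.+-identityʳ _)
    at snk = trans (cong (λ s → 0ℚ + ((if X snk then c else 0ℚ) + s)) (rest-zero {n} (λ _ → false)))
                   (trans (ℚ.+-identityˡ _) (ℚ.+-identityʳ _))
    at (inner j) = trans (ℚ.+-identityˡ _) (trans (ℚ.+-identityˡ _)
                     (Σ-indicator j (λ i → if X (inner i) then c else 0ℚ)))

  -- Summing conservation defects over X, each arc inside X cancels, so only the arcs crossing ∂X remain.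
  ΣNode-excess : ∀ (f : Arc → ℚ) (X : NodeSet n) →
    ΣNode (λ z → if X z then excess f z else 0ℚ)
      ≡ Σ (λ a → (if X (head a) then f a else 0ℚ) - (if X (tail a) then f a else 0ℚ))
  ΣNode-excess f X = trans (ΣNode-cong expand) (trans (ΣNode-Σ-comm F) (Σ-cong per-arc))
    where
    into out : Node n → Arc → ℚ
    into z a = if X z then (if eqNode (head a) z then f a else 0ℚ) else 0ℚ
    out  z a = if X z then (if eqNode (tail a) z then f a else 0ℚ) else 0ℚ
    F : Node n → Arc → ℚ
    F z a = into z a - out z a
    expand : ∀ z → (if X z then excess f z else 0ℚ) ≡ Σ (F z)
    expand z with X z
    ... | true  = sym (Σ-distrib-- (λ a → if eqNode (head a) z then f a else 0ℚ)
                                   (λ a → if eqNode (tail a) z then f a else 0ℚ))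
    ... | false = sym (trans (Σ-cong {length arcs} {g = λ _ → 0ℚ} (λ _ → ℚ.+-inverseʳ 0ℚ)) (Σ-zero (length arcs)))
    per-arc : ∀ a → ΣNode (λ z → F z a) ≡ (if X (head a) then f a else 0ℚ) - (if X (tail a) then f a else 0ℚ)
    per-arc a = trans (ΣNode-distrib-- (λ z → into z a) (λ z → out z a))
                      (cong₂ _-_ (ΣNode-indicator X (head a) (f a)) (ΣNode-indicator X (tail a) (f a)))

_⊆_ : ∀ {n} → NodeSet n → NodeSet n → Set
X ⊆ Y = ∀ z → X z ≡ true → Y z ≡ true

insert : ∀ {n} → Node n → NodeSet n → NodeSet n
insert y X z = eqNode y z ∨ X z

≟-refl : ∀ {n} (i : Fin n) → does (i ≟ i) ≡ true
≟-refl i = cong does (≡-≟-identity _≟_ {i} refl)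

eqNode-refl : ∀ {n} (x : Node n) → eqNode x x ≡ true
eqNode-refl (inner i) = ≟-refl i
eqNode-refl src = refl
eqNode-refl snk = refl

eqNode-sound : ∀ {n} (x y : Node n) → eqNode x y ≡ true → x ≡ y
eqNode-sound (inner i) (inner j) eq with i ≟ j
... | yes refl = refl
eqNode-sound src src _ = refl
eqNode-sound snk snk _ = refl

⊆-insert : ∀ {n} y (X : NodeSet n) → X ⊆ insert y X
⊆-insert y X z Xz rewrite Xz = 𝔹.∨-zeroʳ (eqNode y z)

∈-insert : ∀ {n} y (X : NodeSet n) → insert y X y ≡ true
∈-insert y X rewrite eqNode-refl y = refl

addVertex : ∀ {n} → (Fin n → Bool) → Fin n → Fin n → Bool
addVertex R j i = does (j ≟ i) ∨ R i

withSource-addVertex : ∀ {n} (R : Fin n → Bool) j → withSource (addVertex R j) ⊆ insert (inner j) (withSource R)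
withSource-addVertex R j (inner i) eq = eq
withSource-addVertex R j src       eq = eq

insert-withSource : ∀ {n} (R : Fin n → Bool) j → insert (inner j) (withSource R) ⊆ withSource (addVertex R j)
insert-withSource R j (inner i) eq = eq
insert-withSource R j src       eq = eq

outside : ∀ {n} → (Fin n → Bool) → ℕ
outside R = Σℕ (λ i → if R i then 0 else 1)

outside-addVertex : ∀ {n} (R : Fin n → Bool) j → R j ≡ false → outside R ≡ suc (outside (addVertex R j))
outside-addVertex R j Rj = begin
  outside R                                                                 ≡⟨ Σℕ-split j _ ⟩
  Σℕ (λ i → if does (j ≟ i) then 0 else (if R i then 0 else 1)) +ℕ (if R j then 0 else 1)
                                                                            ≡⟨ cong₂ _+ℕ_ (Σℕ-cong same) (cong (λ b → if b then 0 else 1) Rj) ⟩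
  outside (addVertex R j) +ℕ 1                                              ≡⟨ ℕ.+-comm _ 1 ⟩
  suc (outside (addVertex R j))                                             ∎
  where
  open ≡-Reasoning
  same : ∀ i → (if does (j ≟ i) then 0 else (if R i then 0 else 1)) ≡ (if addVertex R j i then 0 else 1)
  same i with does (j ≟ i)
  ... | true  = refl
  ... | false = refl

if-neg : ∀ b → (if b then - 1ℚ else 0ℚ) ≡ - bitℚ b
if-neg true  = refl
if-neg false = refl

module AugmentingPath {n : ℕ} (arcs : List (Node n × Node n)) (f : Fin (length arcs) → ℚ) (f01 : ZeroOne f) where
  open Network arcs

  Inside : NodeSet n → Arc → Bool
  Inside X a = X (tail a) ∧ X (head a)

  Shifted : Node n → (Arc → ℚ) → Set
  Shifted y h = ∀ z → excess h z ≡ excess f z + (bitℚ (eqNode y z) - bitℚ (eqNode src z))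

  -- f augmented along a residual path from src to y through X
  record PathFlow (X : NodeSet n) (y : Node n) : Set where
    field
      flow    : Arc → ℚ
      zeroOne : ZeroOne flow
      shifted : Shifted y flow
      agrees  : ∀ a → Inside X a ≡ false → flow a ≡ f a

  Inside-mono : ∀ {X Y} → X ⊆ Y → ∀ a → Inside Y a ≡ false → Inside X a ≡ false
  Inside-mono {X} X⊆Y a out with X (tail a) in Xt | X (head a) in Xh
  ... | false | _     = refl
  ... | true  | false = refl
  ... | true  | true  rewrite X⊆Y (tail a) Xt | X⊆Y (head a) Xh = out

  PathFlow-mono : ∀ {X Y y} → X ⊆ Y → PathFlow X y → PathFlow Y y
  PathFlow-mono X⊆Y P = record
    { flow = flow ; zeroOne = zeroOne ; shifted = shifted
    ; agrees = λ a out → agrees a (Inside-mono X⊆Y a out) }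
    where open PathFlow P

  bump-agrees : ∀ {X y} (P : PathFlow X y) {z} a c → Inside (insert z X) a ≡ true →
    ∀ b → Inside (insert z X) b ≡ false → bump (PathFlow.flow P) a c b ≡ f b
  bump-agrees {X} P {z} a c in-a b out-b with a ≟ b
  ... | yes refl = ⊥-elim (𝔹.not-¬ in-a out-b)
  ... | no  _    = trans (ℚ.+-identityʳ _) (PathFlow.agrees P b (Inside-mono (⊆-insert z X) b out-b))

  forward : ∀ {X} a → X (tail a) ≡ true → X (head a) ≡ false → f a ≡ 0ℚ →
            PathFlow X (tail a) → PathFlow (insert (head a) X) (head a)
  forward {X} a Xt Xh fa P = record
    { flow    = bump h a 1ℚ
    ; zeroOne = bump-zeroOne 1ℚ zeroOne (inj₂ (trans (cong (_+ 1ℚ) h≡0) (ℚ.+-identityˡ 1ℚ)))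
    ; shifted = λ z → trans (excess-bump h a 1ℚ z) (trans (cong (_+ _) (shifted z))
        (solve 4 (λ e t s y → (e :+ (t :- s)) :+ (y :- t) := e :+ (y :- s)) refl
               (excess f z) (bitℚ (eqNode (tail a) z)) (bitℚ (eqNode src z)) (bitℚ (eqNode (head a) z))))
    ; agrees  = bump-agrees P {head a} a 1ℚ (cong₂ _∧_ (⊆-insert (head a) X (tail a) Xt) (∈-insert (head a) X))
    }
    where
    open PathFlow P renaming (flow to h)
    h≡0 : h a ≡ 0ℚ
    h≡0 = trans (agrees a (trans (cong (X (tail a) ∧_) Xh) (𝔹.∧-zeroʳ _))) fa

  backward : ∀ {X} a → X (head a) ≡ true → X (tail a) ≡ false → f a ≡ 1ℚ →
             PathFlow X (head a) → PathFlow (insert (tail a) X) (tail a)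
  backward {X} a Xh Xt fa P = record
    { flow    = bump h a (- 1ℚ)
    ; zeroOne = bump-zeroOne (- 1ℚ) zeroOne (inj₁ (trans (cong (_- 1ℚ) h≡1) (ℚ.+-inverseʳ 1ℚ)))
    ; shifted = λ z → trans (excess-bump h a (- 1ℚ) z)
        (trans (cong₂ _+_ (shifted z) (cong₂ _-_ (if-neg (eqNode (head a) z)) (if-neg (eqNode (tail a) z))))
        (solve 4 (λ e h s t → (e :+ (h :- s)) :+ ((:- h) :- (:- t)) := e :+ (t :- s)) refl
               (excess f z) (bitℚ (eqNode (head a) z)) (bitℚ (eqNode src z)) (bitℚ (eqNode (tail a) z))))
    ; agrees  = bump-agrees P {tail a} a (- 1ℚ) (cong₂ _∧_ (∈-insert (tail a) X) (⊆-insert (tail a) X (head a) Xh))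
    }
    where
    open PathFlow P renaming (flow to h)
    h≡1 : h a ≡ 1ℚ
    h≡1 = trans (agrees a (cong (_∧ X (head a)) Xt)) fa

  Residual : NodeSet n → Arc → Set
  Residual X a = (X (tail a) ≡ true × X (head a) ≡ false × f a ≡ 0ℚ)
               ⊎ (X (head a) ≡ true × X (tail a) ≡ false × f a ≡ 1ℚ)

  residual? : ∀ X a → Dec (Residual X a)
  residual? X a = (X (tail a) 𝔹.≟ true ×-dec X (head a) 𝔹.≟ false ×-dec f a ℚ.≟ 0ℚ)
           ⊎-dec (X (head a) 𝔹.≟ true ×-dec X (tail a) 𝔹.≟ false ×-dec f a ℚ.≟ 1ℚ)

  Saturated : NodeSet n → Set
  Saturated X = ∀ a → (X (tail a) ≡ true → X (head a) ≡ false → f a ≡ 1ℚ)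
                    × (X (head a) ≡ true → X (tail a) ≡ false → f a ≡ 0ℚ)

  saturated : ∀ X → (∀ a → ¬ Residual X a) → Saturated X
  saturated X none a = leaving , entering
    where
    leaving : X (tail a) ≡ true → X (head a) ≡ false → f a ≡ 1ℚ
    leaving t h with f01 a
    ... | inj₁ fa = ⊥-elim (none a (inj₁ (t , h , fa)))
    ... | inj₂ fa = fa
    entering : X (head a) ≡ true → X (tail a) ≡ false → f a ≡ 0ℚ
    entering h t with f01 a
    ... | inj₁ fa = fa
    ... | inj₂ fa = ⊥-elim (none a (inj₂ (h , t , fa)))

  extend : ∀ {X} a → Residual X a → (∀ z → X z ≡ true → PathFlow X z) →
           ∃ λ y → X y ≡ false × PathFlow (insert y X) y
  extend a (inj₁ (Xt , Xh , fa)) reach = head a , Xh , forward a Xt Xh fa (reach (tail a) Xt)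
  extend a (inj₂ (Xh , Xt , fa)) reach = tail a , Xt , backward a Xh Xt fa (reach (head a) Xh)

  Reachable : (Fin n → Bool) → Set
  Reachable R = ∀ z → withSource R z ≡ true → PathFlow (withSource R) z

  reachable-addVertex : ∀ {R} j → Reachable R → PathFlow (insert (inner j) (withSource R)) (inner j) →
                        Reachable (addVertex R j)
  reachable-addVertex {R} j reach P z in-z with eqNode (inner j) z in eq
  ... | true  rewrite sym (eqNode-sound (inner j) z eq) = PathFlow-mono (insert-withSource R j) P
  ... | false = PathFlow-mono (λ w → insert-withSource R j w ∘ ⊆-insert (inner j) (withSource R) w)
                              (reach z (subst (λ b → b ∨ withSource R z ≡ true) eq (withSource-addVertex R j z in-z)))

  Augmentation : Set
  Augmentation = ∃ λ h → ZeroOne h × Shifted snk h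

  search : ∀ fuel R → outside R ≤ℕ fuel → Reachable R → Augmentation ⊎ ∃ λ R → Saturated (withSource R)
  search fuel R bound reach with any? (residual? (withSource R))
  ... | no none = inj₂ (R , saturated (withSource R) (λ a r → none (a , r)))
  ... | yes (a , r) with extend a r reach
  ...   | src , () , _
  ...   | snk , _ , P = inj₁ (PathFlow.flow P , PathFlow.zeroOne P , PathFlow.shifted P)
  ...   | inner j , Rj , P with fuel | ℕ.≤-trans (ℕ.≤-reflexive (sym (outside-addVertex R j Rj))) bound
  ...     | suc fuel′ | s≤s bound′ = search fuel′ (addVertex R j) bound′ (reachable-addVertex j reach P)

  start : Reachable (λ _ → false)
  start src _ = record
    { flow = f ; zeroOne = f01 ; agrees = λ _ _ → refl
    ; shifted = λ z → solve 2 (λ e s → e := e :+ (s :- s)) refl (excess f z) (bitℚ (eqNode src z)) }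

  augment : Augmentation ⊎ ∃ λ R → Saturated (withSource R)
  augment = search n (λ _ → false) (ℕ.≤-reflexive (Σℕ-one n)) start

sumL : ∀ {A : Set} → (A → ℕ) → List A → ℕ
sumL w []       = 0
sumL w (x ∷ xs) = w x +ℕ sumL w xs

countᵇ : ∀ {A : Set} → (A → Bool) → List A → ℕ
countᵇ P = sumL (λ x → bit (P x))

Σ-bit-lookup : ∀ {A : Set} (P : A → Bool) (xs : List A) → Σ (λ a → bitℚ (P (lookup xs a))) ≡ fromℕ (countᵇ P xs)
Σ-bit-lookup P []       = refl
Σ-bit-lookup P (x ∷ xs) with P x
... | true  = trans (cong (1ℚ +_) (Σ-bit-lookup P xs)) (sym (fromℕ-suc (countᵇ P xs)))
... | false = trans (cong (0ℚ +_) (Σ-bit-lookup P xs)) (ℚ.+-identityˡ _)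

leaves : ∀ {n} → (Fin n → Bool) → Node n × Node n → Bool
leaves R (x , y) = withSource R x ∧ not (withSource R y)

cutCapacity : ∀ {n} → (Fin n → Bool) → List (Node n × Node n) → ℕ
cutCapacity R = countᵇ (leaves R)

0ℚ≤1ℚ : 0ℚ ≤ 1ℚ
0ℚ≤1ℚ = *≤* (ℤ.+≤+ z≤n)

zeroOne-bounds : ∀ {q} → q ≡ 0ℚ ⊎ q ≡ 1ℚ → (0ℚ ≤ q) × (q ≤ 1ℚ)
zeroOne-bounds (inj₁ refl) = ℚ.≤-refl , 0ℚ≤1ℚ
zeroOne-bounds (inj₂ refl) = 0ℚ≤1ℚ , ℚ.≤-refl

module UnitCapacityFlows {n : ℕ} (arcs : List (Node n × Node n)) where
  open Network arcs
  open AugmentingPath arcs using (Saturated; augment)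

  Conserving : (Arc → ℚ) → Set
  Conserving f = ∀ v → inflow arcs f (inner v) ≡ outflow arcs f (inner v)

  UnitFlow : ℕ → Set
  UnitFlow k = ∃ λ f → ZeroOne f × Conserving f × flowValue arcs f ≡ fromℕ k

  flowValue≡-excess : ∀ f → flowValue arcs f ≡ - excess f src
  flowValue≡-excess f = solve 2 (λ i o → o :- i := :- (i :- o)) refl (inflow arcs f src) (outflow arcs f src)

  -- The value of a conserving flow is its net flow out of any s-side set; on a saturated cut that is the capacity.
  saturated-value : ∀ f (f01 : ZeroOne f) → Conserving f → ∀ R → Saturated f f01 (withSource R) →
                    flowValue arcs f ≡ fromℕ (cutCapacity R arcs)
  saturated-value f f01 cons R sat = begin
    flowValue arcs f                                      ≡⟨ flowValue≡-excess f ⟩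
    - excess f src                                        ≡⟨ cong -_ (sym only-source) ⟩
    - ΣNode (λ z → if X z then excess f z else 0ℚ)        ≡⟨ cong -_ (ΣNode-excess f X) ⟩
    - Σ (λ a → (if X (head a) then f a else 0ℚ) - (if X (tail a) then f a else 0ℚ))
                                                          ≡⟨ cong -_ (trans (Σ-cong per-arc) (Σ-distrib-neg (λ a → bitℚ (leaves R (lookup arcs a))))) ⟩
    - - Σ (λ a → bitℚ (leaves R (lookup arcs a)))         ≡⟨ solve 1 (λ x → :- (:- x) := x) refl _ ⟩
    Σ (λ a → bitℚ (leaves R (lookup arcs a)))             ≡⟨ Σ-bit-lookup (leaves R) arcs ⟩
    fromℕ (cutCapacity R arcs)                            ∎
    where
    open ≡-Reasoning
    X : NodeSet n
    X = withSource R
    balanced : ∀ i → (if R i then excess f (inner i) else 0ℚ) ≡ 0ℚ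
    balanced i with R i
    ... | true  = trans (cong (_- outflow arcs f (inner i)) (cons i)) (ℚ.+-inverseʳ (outflow arcs f (inner i)))
    ... | false = refl
    only-source : ΣNode (λ z → if X z then excess f z else 0ℚ) ≡ excess f src
    only-source = trans (cong (λ w → excess f src + (0ℚ + w)) (trans (Σ-cong balanced) (Σ-zero n)))
                        (ℚ.+-identityʳ _)
    per-arc : ∀ a → (if X (head a) then f a else 0ℚ) - (if X (tail a) then f a else 0ℚ)
                    ≡ - bitℚ (leaves R (lookup arcs a))
    per-arc a with X (tail a) in Xt | X (head a) in Xh
    ... | true  | true  = ℚ.+-inverseʳ (f a)
    ... | true  | false rewrite proj₁ (sat a) Xt Xh = refl
    ... | false | true  rewrite proj₂ (sat a) Xh Xt = refl
    ... | false | false = refl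

  zeroFlow : UnitFlow 0
  zeroFlow = (λ _ → 0ℚ) , (λ _ → inj₁ refl) , (λ v → trans (none _) (sym (none _)))
           , trans (cong₂ _-_ (none _) (none _)) (ℚ.+-inverseʳ 0ℚ)
    where
    none : ∀ (P : Arc → Bool) → Σ (λ a → if P a then 0ℚ else 0ℚ) ≡ 0ℚ
    none P = trans (Σ-cong (λ a → if-same (P a) 0ℚ)) (Σ-zero (length arcs))

  augmented-flow : ∀ {k} f f01 → Conserving f → flowValue arcs f ≡ fromℕ k →
                   AugmentingPath.Augmentation arcs f f01 → UnitFlow (suc k)
  augmented-flow {k} f f01 cons val (h , h01 , shifted) = h , h01 , conserving , value
    where
    open import Algebra.Properties.Group ℚ.+-0-group using (x∙y⁻¹≈ε⇒x≈y)
    conserving : Conserving h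
    conserving i = x∙y⁻¹≈ε⇒x≈y _ _ (begin
      excess h (inner i)                 ≡⟨ shifted (inner i) ⟩
      excess f (inner i) + (0ℚ - 0ℚ)     ≡⟨ cong (_+ (0ℚ - 0ℚ)) (trans (cong (_- outflow arcs f (inner i)) (cons i))
                                                                       (ℚ.+-inverseʳ (outflow arcs f (inner i)))) ⟩
      0ℚ + (0ℚ - 0ℚ)                     ≡⟨⟩
      0ℚ                                 ∎)
      where open ≡-Reasoning
    value : flowValue arcs h ≡ fromℕ (suc k)
    value = begin
      flowValue arcs h                   ≡⟨ flowValue≡-excess h ⟩
      - excess h src                     ≡⟨ cong -_ (shifted src) ⟩
      - (excess f src + (0ℚ - 1ℚ))       ≡⟨ solve 2 (λ e o → :- (e :+ (:- o)) := (:- e) :+ o) refl (excess f src) 1ℚ ⟩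
      - excess f src + 1ℚ                ≡⟨ cong (_+ 1ℚ) (trans (sym (flowValue≡-excess f)) val) ⟩
      fromℕ k + 1ℚ                       ≡⟨ trans (ℚ.+-comm (fromℕ k) 1ℚ) (sym (fromℕ-suc k)) ⟩
      fromℕ (suc k)                      ∎
      where open ≡-Reasoning

  unitFlow : ∀ L → (∀ R → L ≤ℕ cutCapacity R arcs) → ∀ k → k ≤ℕ L → UnitFlow k
  unitFlow L cut zero    _    = zeroFlow
  unitFlow L cut (suc k) 1+k≤L with unitFlow L cut k (ℕ.≤-trans (ℕ.n≤1+n k) 1+k≤L)
  ... | f , f01 , cons , val with augment f f01
  ...   | inj₁ aug       = augmented-flow {k} f f01 cons val aug
  ...   | inj₂ (R , sat) = ⊥-elim (ℕ.<-irrefl k≡cap (ℕ.≤-trans 1+k≤L (cut R)))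
    where
    k≡cap : k ≡ cutCapacity R arcs
    k≡cap = fromℕ-injective (trans (sym val) (saturated-value f f01 cons R sat))

  hasFlowOfValue : ∀ L → (∀ R → L ≤ℕ cutCapacity R arcs) → HasFlowOfValue arcs L
  hasFlowOfValue L cut with unitFlow L cut L ℕ.≤-refl
  ... | f , f01 , cons , val = f , ((λ a → zeroOne-bounds (f01 a)) , cons) , val

sumL-++ : ∀ {A : Set} (w : A → ℕ) xs ys → sumL w (xs ++ ys) ≡ sumL w xs +ℕ sumL w ys
sumL-++ w []       ys = refl
sumL-++ w (x ∷ xs) ys = trans (cong (w x +ℕ_) (sumL-++ w xs ys)) (sym (ℕ.+-assoc (w x) _ _))

sumL-concatMap : ∀ {A B : Set} (w : B → ℕ) (g : A → List B) xs →
                 sumL w (concatMap g xs) ≡ sumL (λ x → sumL w (g x)) xs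
sumL-concatMap w g []       = refl
sumL-concatMap w g (x ∷ xs) =
  trans (sumL-++ w (g x) (concatMap g xs)) (cong (sumL w (g x) +ℕ_) (sumL-concatMap w g xs))

sumL-map : ∀ {A B : Set} (w : B → ℕ) (g : A → B) xs → sumL w (map g xs) ≡ sumL (λ x → w (g x)) xs
sumL-map w g []       = refl
sumL-map w g (x ∷ xs) = cong (w (g x) +ℕ_) (sumL-map w g xs)

sumL-tabulate : ∀ {A : Set} {m} (w : A → ℕ) (g : Fin m → A) → sumL w (tabulate g) ≡ Σℕ (λ i → w (g i))
sumL-tabulate {m = zero}  w g = refl
sumL-tabulate {m = suc m} w g = cong (w (g fzero) +ℕ_) (sumL-tabulate w (λ i → g (fsuc i)))

countᵇ-filterᵇ : ∀ {A : Set} (P Q : A → Bool) xs → countᵇ P (filterᵇ Q xs) ≡ countᵇ (λ x → Q x ∧ P x) xs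
countᵇ-filterᵇ P Q []       = refl
countᵇ-filterᵇ P Q (x ∷ xs) with Q x
... | true  = cong (bit (P x) +ℕ_) (countᵇ-filterᵇ P Q xs)
... | false = countᵇ-filterᵇ P Q xs

length-filterᵇ : ∀ {A : Set} (Q : A → Bool) xs → length (filterᵇ Q xs) ≡ countᵇ Q xs
length-filterᵇ Q []       = refl
length-filterᵇ Q (x ∷ xs) with Q x
... | true  = cong suc (length-filterᵇ Q xs)
... | false = length-filterᵇ Q xs

Σ² : ∀ {n} → (Fin n → Fin n → ℕ) → ℕ
Σ² g = Σℕ (λ i → Σℕ (g i))

Σ²-cong : ∀ {n} {g g′ : Fin n → Fin n → ℕ} → (∀ i j → g i j ≡ g′ i j) → Σ² g ≡ Σ² g′
Σ²-cong eq = Σℕ-cong (λ i → Σℕ-cong (eq i))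

Σ²-distrib-+ : ∀ {n} (g g′ : Fin n → Fin n → ℕ) → Σ² (λ i j → g i j +ℕ g′ i j) ≡ Σ² g +ℕ Σ² g′
Σ²-distrib-+ g g′ = trans (Σℕ-cong (λ i → Σℕ-distrib-+ (g i) (g′ i))) (Σℕ-distrib-+ (λ i → Σℕ (g i)) (λ i → Σℕ (g′ i)))

countᵇ-allPairs : ∀ {n} (P : Fin n × Fin n → Bool) → countᵇ P (allPairs n) ≡ Σ² (λ i j → bit (P (i , j)))
countᵇ-allPairs {n} P = begin
  countᵇ P (allPairs n)
    ≡⟨ sumL-concatMap (λ p → bit (P p)) row (allFin n) ⟩
  sumL (λ i → countᵇ P (row i)) (allFin n)
    ≡⟨ sumL-tabulate (λ i → countᵇ P (row i)) (λ i → i) ⟩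
  Σℕ (λ i → countᵇ P (row i))
    ≡⟨ Σℕ-cong (λ i → trans (sumL-map (λ p → bit (P p)) (i ,_) (allFin n))
                             (sumL-tabulate (λ j → bit (P (i , j))) (λ j → j))) ⟩
  Σ² (λ i j → bit (P (i , j)))  ∎
  where
  open ≡-Reasoning
  row : Fin n → List (Fin n × Fin n)
  row i = map (i ,_) (allFin n)

_<ᶠ_ : ∀ {n} → Fin n → Fin n → Bool
i <ᶠ j = toℕ i <ᵇ toℕ j

<ᶠ-true : ∀ {n} {i j : Fin n} → toℕ i <ℕ toℕ j → (i <ᶠ j) ≡ true
<ᶠ-true i<j = Equivalence.to 𝔹.T-≡ (ℕ.<⇒<ᵇ i<j)

<ᶠ-false : ∀ {n} {i j : Fin n} → ¬ toℕ i <ℕ toℕ j → (i <ᶠ j) ≡ false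
<ᶠ-false {i = i} {j} i≮j = 𝔹.¬-not (λ lt → i≮j (ℕ.<ᵇ⇒< (toℕ i) (toℕ j) (Equivalence.from 𝔹.T-≡ lt)))

bit-split-<ᶠ : ∀ {n} (G : Fin n → Fin n → Bool) → (∀ i → G i i ≡ false) → ∀ i j →
               bit (G i j) ≡ bit ((i <ᶠ j) ∧ G i j) +ℕ bit ((j <ᶠ i) ∧ G i j)
bit-split-<ᶠ G irr i j with ℕ.<-cmp (toℕ i) (toℕ j)
... | tri< i<j _ j≮i rewrite <ᶠ-true {i = i} {j} i<j | <ᶠ-false {i = j} {i} j≮i = sym (ℕ.+-identityʳ _)
... | tri> i≮j _ j<i rewrite <ᶠ-false {i = i} {j} i≮j | <ᶠ-true {i = j} {i} j<i = refl
... | tri≈ _ i≡j _ rewrite toℕ-injective i≡j | irr j | 𝔹.∧-zeroʳ (j <ᶠ j) = refl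

Σ²-ordered : ∀ {n} (G H : Fin n → Fin n → Bool) → (∀ i → G i i ≡ false) →
             (∀ i j → bit (G i j) +ℕ bit (G j i) ≡ bit (H i j)) →
             Σ² (λ i j → bit (G i j)) ≡ Σ² (λ i j → bit ((i <ᶠ j) ∧ H i j))
Σ²-ordered G H irr G+Gᵀ≡H = begin
  Σ² (λ i j → bit (G i j))                    ≡⟨ Σ²-cong (bit-split-<ᶠ G irr) ⟩
  Σ² (λ i j → up i j +ℕ down i j)             ≡⟨ Σ²-distrib-+ up down ⟩
  Σ² up +ℕ Σ² down                            ≡⟨ cong (Σ² up +ℕ_) (Σℕ-comm down) ⟩
  Σ² up +ℕ Σ² (λ i j → down j i)              ≡⟨ sym (Σ²-distrib-+ up (λ i j → down j i)) ⟩
  Σ² (λ i j → up i j +ℕ down j i)             ≡⟨ Σ²-cong pair ⟩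
  Σ² (λ i j → bit ((i <ᶠ j) ∧ H i j))         ∎
  where
  open ≡-Reasoning
  up down : _ → _ → ℕ
  up   i j = bit ((i <ᶠ j) ∧ G i j)
  down i j = bit ((j <ᶠ i) ∧ G i j)
  pair : ∀ i j → up i j +ℕ down j i ≡ bit ((i <ᶠ j) ∧ H i j)
  pair i j with i <ᶠ j
  ... | true  = G+Gᵀ≡H i j
  ... | false = refl

Σ²-split : ∀ {n} (a b : Fin n) (g : Fin n → Fin n → ℕ) →
           Σ² g ≡ Σ² (λ i j → if does (a ≟ i) ∧ does (b ≟ j) then 0 else g i j) +ℕ g a b
Σ²-split a b g = begin
  Σ² g                                              ≡⟨ Σℕ-split a (λ i → Σℕ (g i)) ⟩
  Σℕ others +ℕ Σℕ (g a)                             ≡⟨ cong (Σℕ others +ℕ_) (trans (Σℕ-split b (g a)) (cong (_+ℕ g a b) (Σℕ-cong at-a))) ⟩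
  Σℕ others +ℕ (Σℕ (g′ a) +ℕ g a b)                 ≡⟨ sym (ℕ.+-assoc (Σℕ others) _ _) ⟩
  Σℕ others +ℕ Σℕ (g′ a) +ℕ g a b                   ≡⟨ cong (_+ℕ g a b) (sym (trans (Σℕ-split a (λ i → Σℕ (g′ i)))
                                                                             (cong (_+ℕ Σℕ (g′ a)) (Σℕ-cong same)))) ⟩
  Σ² g′ +ℕ g a b                                    ∎
  where
  open ≡-Reasoning
  g′ : Fin _ → Fin _ → ℕ
  g′ i j = if does (a ≟ i) ∧ does (b ≟ j) then 0 else g i j
  others : Fin _ → ℕ
  others i = if does (a ≟ i) then 0 else Σℕ (g i)
  at-a : ∀ j → (if does (b ≟ j) then 0 else g a j) ≡ g′ a j
  at-a j rewrite ≟-refl a = refl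
  same : ∀ i → (if does (a ≟ i) then 0 else Σℕ (g′ i)) ≡ others i
  same i with does (a ≟ i)
  ... | true  = refl
  ... | false = refl

-- A duplicate-free list is counted against Q by removing each of its entries from Q in turn.
countᵇ-≤-Σ² : ∀ {n} (P Q : Fin n × Fin n → Bool) xs → AllPairs (λ x y → ¬ x ≡ y) xs →
              All (λ x → P x ≡ true → Q x ≡ true) xs → countᵇ P xs ≤ℕ Σ² (λ i j → bit (Q (i , j)))
countᵇ-≤-Σ² P Q []       _            _            = z≤n
countᵇ-≤-Σ² P Q (x ∷ xs) (x∉xs ∷ dup) (P⇒Q ∷ P⇒Qs) with P x
... | false = countᵇ-≤-Σ² P Q xs dup P⇒Qs
... | true  = begin
  suc (countᵇ P xs)                                     ≤⟨ s≤s (countᵇ-≤-Σ² P Q′ xs dup (still P⇒Qs x∉xs)) ⟩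
  suc (Σ² (λ i j → bit (Q′ (i , j))))                   ≡⟨ cong suc (Σ²-cong removed) ⟩
  suc rest                                              ≡⟨ ℕ.+-comm 1 rest ⟩
  rest +ℕ 1                                             ≡⟨ cong (λ b → rest +ℕ bit b) (sym (P⇒Q refl)) ⟩
  rest +ℕ bit (Q x)                                     ≡⟨ sym (Σ²-split (proj₁ x) (proj₂ x) (λ i j → bit (Q (i , j)))) ⟩
  Σ² (λ i j → bit (Q (i , j)))                          ∎
  where
  open ℕ.≤-Reasoning
  hit : _ → Bool
  hit p = does (proj₁ x ≟ proj₁ p) ∧ does (proj₂ x ≟ proj₂ p)
  rest : ℕ
  rest = Σ² (λ i j → if hit (i , j) then 0 else bit (Q (i , j)))
  Q′ : _ → Bool
  Q′ p = not (hit p) ∧ Q p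
  removed : ∀ i j → bit (Q′ (i , j)) ≡ (if hit (i , j) then 0 else bit (Q (i , j)))
  removed i j with hit (i , j)
  ... | true  = refl
  ... | false = refl
  miss : ∀ {y} → ¬ x ≡ y → hit y ≡ false
  miss {y} x≢y with proj₁ x ≟ proj₁ y | proj₂ x ≟ proj₂ y
  ... | yes eq₁ | yes eq₂ = ⊥-elim (x≢y (cong₂ _,_ eq₁ eq₂))
  ... | yes _   | no _    = refl
  ... | no _    | _       = refl
  still : ∀ {ys} → All (λ y → P y ≡ true → Q y ≡ true) ys → All (λ y → ¬ x ≡ y) ys →
          All (λ y → P y ≡ true → Q′ y ≡ true) ys
  still []         []           = []
  still (pq ∷ pqs) (x≢y ∷ x≢ys) = (λ Py → cong₂ _∧_ (cong not (miss x≢y)) (pq Py)) ∷ still pqs x≢ys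

cutSize-Σ² : ∀ {n} (G : SimpleGraph n) (S : Cut n) →
             cutSize G S ≡ Σ² (λ i j → bit ((i <ᶠ j) ∧ (adj G i j ∧ (S i xor S j))))
cutSize-Σ² {n} G S = trans (length-filterᵇ _ (allPairs n)) (countᵇ-allPairs {n} _)

xor-interchange : ∀ a b c d → (a xor b) xor (c xor d) ≡ (a xor c) xor (b xor d)
xor-interchange = interchange
  where open import Algebra.Properties.CommutativeSemigroup
                      (Algebra.Bundles.CommutativeRing.+-commutativeSemigroup 𝔹.xor-∧-commutativeRing)

-- x, r say whether an edge crosses the cut, resp. R; flipping R makes it cross iff x xor r.
bit-flip : ∀ c a x r → bit (c ∧ (a ∧ (x xor r))) +ℕ bit (c ∧ (a ∧ (x ∧ r)))
                     ≡ bit (c ∧ (a ∧ x)) +ℕ bit (c ∧ (a ∧ (not x ∧ r)))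
bit-flip false a     x     r     = refl
bit-flip true  false x     r     = refl
bit-flip true  true  true  true  = refl
bit-flip true  true  true  false = refl
bit-flip true  true  false true  = refl
bit-flip true  true  false false = refl

bit-orient : ∀ a t r s → bit (a ∧ (t ∧ (r ∧ not s))) +ℕ bit (a ∧ (t ∧ (s ∧ not r))) ≡ bit (a ∧ (t ∧ (r xor s)))
bit-orient false t     r     s     = refl
bit-orient true  false r     s     = refl
bit-orient true  true  true  true  = refl
bit-orient true  true  true  false = refl
bit-orient true  true  false true  = refl
bit-orient true  true  false false = refl

module FlipCut {n : ℕ} (G : SimpleGraph n) (S : Cut n) (R : Fin n → Bool) where

  otherSide sameSide : Fin n → Fin n → Bool
  otherSide i j = S i xor S j
  sameSide  i j = not (otherSide i j)

  otherSide-sym : ∀ i j → otherSide i j ≡ otherSide j i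
  otherSide-sym i j = 𝔹.xor-comm (S i) (S j)

  sameSide-sym : ∀ i j → sameSide i j ≡ sameSide j i
  sameSide-sym i j = cong not (otherSide-sym i j)

  leavingR acrossR : (Fin n → Fin n → Bool) → Fin n → Fin n → Bool
  leavingR T i j = adj G i j ∧ (T i j ∧ (R i ∧ not (R j)))
  acrossR  T i j = adj G i j ∧ (T i j ∧ (R i xor R j))

  Σ²-leavingR : ∀ T → (∀ i j → T i j ≡ T j i) →
                Σ² (λ i j → bit (leavingR T i j)) ≡ Σ² (λ i j → bit ((i <ᶠ j) ∧ acrossR T i j))
  Σ²-leavingR T T-sym = Σ²-ordered (leavingR T) (acrossR T) (λ i → cong (_∧ _) (irrefl G i)) both
    where
    both : ∀ i j → bit (leavingR T i j) +ℕ bit (leavingR T j i) ≡ bit (acrossR T i j)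
    both i j rewrite SimpleGraph.sym G j i | T-sym j i = bit-orient (adj G i j) (T i j) (R i) (R j)

  flipped : Cut n
  flipped i = S i xor R i

  -- cut(S) + (internal edges across R) = cut(S xor R) + (cut edges across R), and cut(S xor R) ≤ cut(S).
  across-same≤across-other : IsMaxCut G S →
    Σ² (λ i j → bit ((i <ᶠ j) ∧ acrossR sameSide i j)) ≤ℕ Σ² (λ i j → bit ((i <ᶠ j) ∧ acrossR otherSide i j))
  across-same≤across-other maxCut = ℕ.+-cancelˡ-≤ (cutSize G S) _ _ (begin
    cutSize G S +ℕ Σ² internal               ≡⟨ cong (_+ℕ Σ² internal) (cutSize-Σ² G S) ⟩
    Σ² cut +ℕ Σ² internal                    ≡⟨ sym (Σ²-distrib-+ cut internal) ⟩
    Σ² (λ i j → cut i j +ℕ internal i j)     ≡⟨ Σ²-cong exchange ⟩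
    Σ² (λ i j → cut′ i j +ℕ external i j)    ≡⟨ Σ²-distrib-+ cut′ external ⟩
    Σ² cut′ +ℕ Σ² external                   ≡⟨ cong (_+ℕ Σ² external) (sym (cutSize-Σ² G flipped)) ⟩
    cutSize G flipped +ℕ Σ² external         ≤⟨ ℕ.+-monoˡ-≤ (Σ² external) (maxCut flipped) ⟩
    cutSize G S +ℕ Σ² external               ∎)
    where
    open ℕ.≤-Reasoning
    cut cut′ internal external : Fin n → Fin n → ℕ
    cut      i j = bit ((i <ᶠ j) ∧ (adj G i j ∧ (S i xor S j)))
    cut′     i j = bit ((i <ᶠ j) ∧ (adj G i j ∧ (flipped i xor flipped j)))
    internal i j = bit ((i <ᶠ j) ∧ acrossR sameSide i j)
    external i j = bit ((i <ᶠ j) ∧ acrossR otherSide i j)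
    exchange : ∀ i j → cut i j +ℕ internal i j ≡ cut′ i j +ℕ external i j
    exchange i j rewrite xor-interchange (S i) (R i) (S j) (R j) =
      sym (bit-flip (i <ᶠ j) (adj G i j) (S i xor S j) (R i xor R j))

  leavesEdge : Fin n × Fin n → Bool
  leavesEdge (u , v) = R u ∧ not (R v)

  terminalArcs : Fin n × Fin n → List (Node n × Node n)
  terminalArcs (u , v) = (src , inner u) ∷ (inner v , snk) ∷ []

  cutArcs : List (Node n × Node n)
  cutArcs = map (λ p → inner (proj₁ p) , inner (proj₂ p))
                (filterᵇ (λ p → adj G (proj₁ p) (proj₂ p) ∧ otherSide (proj₁ p) (proj₂ p)) (allPairs n))

  cutCapacity-cutArcs : cutCapacity R cutArcs ≡ Σ² (λ i j → bit (leavingR otherSide i j))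
  cutCapacity-cutArcs = begin
    cutCapacity R cutArcs
      ≡⟨ sumL-map _ _ (filterᵇ _ (allPairs n)) ⟩
    countᵇ leavesEdge (filterᵇ (λ p → adj G (proj₁ p) (proj₂ p) ∧ otherSide (proj₁ p) (proj₂ p)) (allPairs n))
      ≡⟨ countᵇ-filterᵇ leavesEdge _ (allPairs n) ⟩
    countᵇ (λ p → (adj G (proj₁ p) (proj₂ p) ∧ otherSide (proj₁ p) (proj₂ p)) ∧ leavesEdge p) (allPairs n)
      ≡⟨ countᵇ-allPairs {n} _ ⟩
    Σ² (λ i j → bit ((adj G i j ∧ otherSide i j) ∧ leavesEdge (i , j)))
      ≡⟨ Σ²-cong (λ i j → cong bit (𝔹.∧-assoc (adj G i j) (otherSide i j) _)) ⟩
    Σ² (λ i j → bit (leavingR otherSide i j))  ∎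
    where open ≡-Reasoning

  length≤terminal+leavesEdge : ∀ xs → length xs ≤ℕ cutCapacity R (concatMap terminalArcs xs) +ℕ countᵇ leavesEdge xs
  length≤terminal+leavesEdge []       = z≤n
  length≤terminal+leavesEdge ((u , v) ∷ xs) with R u | R v
  ... | false | Rv    = s≤s (ℕ.≤-trans (length≤terminal+leavesEdge xs) (ℕ.+-monoˡ-≤ _ (ℕ.m≤n+m _ (bit (Rv ∧ true)))))
  ... | true  | true  = s≤s (length≤terminal+leavesEdge xs)
  ... | true  | false = ℕ.≤-trans (s≤s (length≤terminal+leavesEdge xs)) (ℕ.≤-reflexive (sym (ℕ.+-suc _ _)))

  leavesEdge≤leavingR-sameSide : ∀ Fσ → IsOrientedInternalEdgeSet G S Fσ →
                                  countᵇ leavesEdge Fσ ≤ℕ Σ² (λ i j → bit (leavingR sameSide i j))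
  leavesEdge≤leavingR-sameSide Fσ (internal , distinct) =
    countᵇ-≤-Σ² leavesEdge (λ p → leavingR sameSide (proj₁ p) (proj₂ p)) Fσ
      (AllPairs.map (λ ¬same x≡y → ¬same (inj₁ (cong proj₁ x≡y , cong proj₂ x≡y))) distinct)
      (All.map (λ { {u , v} (uv∈E , Su≡Sv) leaves → cong₂ _∧_ uv∈E (cong₂ _∧_ (same Su≡Sv) leaves) }) internal)
    where
    same : ∀ {u v} → S u ≡ S v → sameSide u v ≡ true
    same {u} Su≡Sv rewrite Su≡Sv = cong not (𝔹.xor-same (S _))

  network-cutCapacity : IsMaxCut G S → ∀ Fσ → IsOrientedInternalEdgeSet G S Fσ →
                        length Fσ ≤ℕ cutCapacity R (networkArcs G S Fσ)
  network-cutCapacity maxCut Fσ internalσ = begin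
    length Fσ                                                       ≤⟨ length≤terminal+leavesEdge Fσ ⟩
    terminal +ℕ countᵇ leavesEdge Fσ                                ≤⟨ ℕ.+-monoʳ-≤ terminal (leavesEdge≤leavingR-sameSide Fσ internalσ) ⟩
    terminal +ℕ Σ² (λ i j → bit (leavingR sameSide i j))            ≡⟨ cong (terminal +ℕ_) (Σ²-leavingR sameSide sameSide-sym) ⟩
    terminal +ℕ Σ² (λ i j → bit ((i <ᶠ j) ∧ acrossR sameSide i j))  ≤⟨ ℕ.+-monoʳ-≤ terminal (across-same≤across-other maxCut) ⟩
    terminal +ℕ Σ² (λ i j → bit ((i <ᶠ j) ∧ acrossR otherSide i j)) ≡⟨ cong (terminal +ℕ_) (sym (Σ²-leavingR otherSide otherSide-sym)) ⟩
    terminal +ℕ Σ² (λ i j → bit (leavingR otherSide i j))           ≡⟨ cong (terminal +ℕ_) (sym cutCapacity-cutArcs) ⟩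
    terminal +ℕ cutCapacity R cutArcs                               ≡⟨ ℕ.+-comm terminal _ ⟩
    cutCapacity R cutArcs +ℕ terminal                               ≡⟨ sym (sumL-++ _ cutArcs (concatMap terminalArcs Fσ)) ⟩
    cutCapacity R (networkArcs G S Fσ)                              ∎
    where
    open ℕ.≤-Reasoning
    terminal : ℕ
    terminal = cutCapacity R (concatMap terminalArcs Fσ)

lemma1 : ∀ (n : ℕ) (G : SimpleGraph n) (S : Cut n) → IsMaxCut G S →
           (Fσ : List (Fin n × Fin n)) → IsOrientedInternalEdgeSet G S Fσ →
           HasFlowOfValue (networkArcs G S Fσ) (length Fσ)
lemma1 n G S maxCut Fσ internalσ =
  UnitCapacityFlows.hasFlowOfValue (networkArcs G S Fσ) (length Fσ)
    (λ R → FlipCut.network-cutCapacity G S R maxCut Fσ internalσ)
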